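{- Let $c_{k,i}$ be the number of atomic set compositions of $[k]$ with exactly $i$ parts, and $S_{n,r}$ the Stirling numbers of the second kind (with $S_{0,0}=1$, $S_{n,0}=0$ for $n\ge1$). Then $$\frac{1}{1-\sum_{k\geq1} \sum_{i=1}^{k} c_{k,i}\, t^i q^k} = \sum_{n\geq0}\sum_{r\geq0} r!\,S_{n,r}\, t^r q^n .$$
   Context: A set composition $\Phi$ of $[n]$ (written $\Phi\models[n]$) is a sequence $(\Phi_1,\dots,\Phi_\ell)$ of nonempty pairwise disjoint subsets of $[n]$ with union $[n]$; $\ell(\Phi)=\ell$ is its length. The number of set compositions of $[n]$ of length $r$ is $r!S_{n,r}$. For $\Phi\models[n]$, $\Psi\models[k]$, $\Phi|\Psi=(\Phi_1,\dots,\Phi_{\ell(\Phi)},\Psi_1+n,\dots,\Psi_{\ell(\Psi)}+n)\models[n+k]$, where $\Psi_j+n$ adds $n$ to each element. $\Phi\models[n]$ is atomic if $n\ge1$ and $\Phi\ne\Psi|\Gamma$ for all $\Psi\models[j]$, $\Gamma\models[n-j]$ with $0<j<n$. -}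

module Defs where

open import Data.Nat using (ℕ; zero; suc; _+_; _*_; _∸_; _≤_; _<_; _≤ᵇ_; _!)

open import Data.Integer as ℤ using (ℤ)
open import Data.Bool using (Bool; true; false; _∧_; if_then_else_)
open import Data.Fin using (Fin)
open import Data.Fin.Subset using (Subset; _∈_; outside)
open import Data.Vec using (Vec; lookup; replicate; _++_; map; toList)
open import Data.List as List using (List)
open import Data.List.Relation.Unary.Unique.Propositional using (Unique)
import Data.List.Membership.Propositional as Mem
open import Data.Product using (Σ; ∃; ∃-syntax; _×_)
open import Relation.Binary.PropositionalEquality using (_≡_; _≢_)
open import Relation.Nullary using (¬_)
open import Function.Bundles using (_⇔_)

IsSetComp : {n ℓ : ℕ} → Vec (Subset n) ℓ → Set
IsSetComp {n} {ℓ} Φ =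
  (∀ (i : Fin ℓ) → ∃[ x ] x ∈ lookup Φ i)
  × (∀ (i j : Fin ℓ) → i ≢ j → ∀ (x : Fin n) → x ∈ lookup Φ i → ¬ (x ∈ lookup Φ j))
  × (∀ (x : Fin n) → ∃[ i ] x ∈ lookup Φ i)

_∣∣_ : {j m a b : ℕ} → Vec (Subset j) a → Vec (Subset m) b → Vec (Subset (j + m)) (a + b)
_∣∣_ {j} {m} Φ Ψ = map (λ p → p ++ replicate m outside) Φ ++ map (λ q → replicate j outside ++ q) Ψ

-- forget the indices, to compare compositions of possibly different index shapes
flatten : {n ℓ : ℕ} → Vec (Subset n) ℓ → List (List Bool)
flatten Φ = toList (map toList Φ)

IsAtomic : {n ℓ : ℕ} → Vec (Subset n) ℓ → Set
IsAtomic {n} Φ =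
  1 ≤ n
  × ¬ (Σ ℕ λ j → Σ ℕ λ m → Σ ℕ λ a → Σ ℕ λ b →
        Σ (Vec (Subset j) a) λ Ψ → Σ (Vec (Subset m) b) λ Γ →
          0 < j × 0 < m × j + m ≡ n × IsSetComp Ψ × IsSetComp Γ
          × flatten (Ψ ∣∣ Γ) ≡ flatten Φ)

IsCount : {A : Set} → (A → Set) → ℕ → Set
IsCount {A} P c = Σ (List A) λ L → Unique L × List.length L ≡ c × (∀ x → (x Mem.∈ L) ⇔ P x)

S : ℕ → ℕ → ℕ
S zero zero = 1
S zero (suc r) = 0
S (suc n) zero = 0
S (suc n) (suc r) = suc r * S n (suc r) + S n r

-- Bivariate formal power series Σ a(n,r) q^n t^r over ℤ, as coefficient functions
-- (first index = exponent of q, second = exponent of t).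
Series : Set
Series = ℕ → ℕ → ℤ

sumTo : ℕ → (ℕ → ℤ) → ℤ
sumTo zero f = f 0
sumTo (suc n) f = sumTo n f ℤ.+ f (suc n)

oneS : Series
oneS zero zero = ℤ.+ 1
oneS _ _ = ℤ.+ 0

_-S_ : Series → Series → Series
(F -S G) n r = F n r ℤ.- G n r

_*S_ : Series → Series → Series
(F *S G) n r = sumTo n λ k → sumTo r λ i → F k i ℤ.* G (n ∸ k) (r ∸ i)

atomicSeries : (ℕ → ℕ → ℕ) → Series
atomicSeries c k i =
  if (1 ≤ᵇ k) ∧ (1 ≤ᵇ i) ∧ (i ≤ᵇ k) then ℤ.+ (c k i) else ℤ.+ 0

compSeries : Series
compSeries n r = ℤ.+ ((r !) * S n r)

module Submission where

-- A set composition Φ of [n] with r blocks is recorded by its index word, which sends each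
-- element to the number of its block: these are exactly the words of length n over the letters
-- 0, …, r-1 that use every letter, and Φ|Ψ becomes concatenation with the letters of the second
-- word shifted past those of the first. A surjective word of positive length factors uniquely as
-- an atomic word followed by a surjective word, the atomic factor being its shortest prefix that
-- splits off. Counting both sides gives r! S(n,r) = Σ_{k,i} c_{k,i} (r-i)! S(n-k,r-i) for n ≥ 1,
-- which is the coefficient of t^r q^n in (1 - A) C = 1; for n = 0 both sides are [r = 0].

open import Defs
open import Data.Nat using (ℕ; zero; suc; _+_; _*_; _∸_; _≤_; _<_; z≤n; s≤s; z<s; _!; pred; _≡ᵇ_; _≤ᵇ_)
open import Data.Nat.Properties
open import Data.Nat.Induction using (<-rec)
open import Data.Nat.Solver using (module +-*-Solver)
open import Data.Integer as ℤ using (ℤ)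
import Data.Integer.Properties as ℤ
open import Data.Integer.Solver using () renaming (module +-*-Solver to ℤ-Solver)
open import Data.Bool using (Bool; true; false; if_then_else_; _∧_)
open import Data.Bool.Properties using (T-≡; ¬-not; if-eta)
open import Data.Fin using (Fin; zero; suc; toℕ; fromℕ<)
import Data.Fin.Properties as Fin
open import Data.Fin.Subset using (Subset) renaming (_∈_ to _∈ₛ_)
open import Data.Fin.Subset.Properties using (⊆-antisym)
open import Data.List
  using (List; []; _∷_; _++_; map; length; upTo; take; drop; cartesianProductWith)
open import Data.List.Properties
  using (length-++; length-map; length-upTo; length-take; length-drop; map-injective; ∷-injective;
         ++-assoc; map-++; map-∘; map-cong; map-id-local; take++drop≡id; ++-identityʳ; take-map; ++-cancelˡ)
open import Data.List.Extrema.Nat using (max; xs≤max; max≤v⁺)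
open import Data.List.Membership.Propositional using (_∈_; lose)
open import Data.List.Membership.Propositional.Properties
  using (∈-++⁺ˡ; ∈-++⁺ʳ; ∈-++⁻; ∈-map⁺; ∈-map⁻; ∈-upTo⁺; ∈-upTo⁻;
         ∈-cartesianProductWith⁺; ∈-cartesianProductWith⁻)
open import Data.List.Membership.Propositional.Properties.WithK using (unique∧set⇒bag)
open import Data.List.Membership.DecPropositional _≟_ using (_∈?_)
open import Data.List.Relation.Binary.BagAndSetEquality using (∼bag⇒↭)
open import Data.List.Relation.Binary.Permutation.Propositional.Properties using (↭-length)
open import Data.List.Relation.Unary.All as All using (All; []; _∷_)
import Data.List.Relation.Unary.All.Properties as All
open import Data.List.Relation.Unary.AllPairs using ([]; _∷_)
open import Data.List.Relation.Unary.Any using (here; there; any?; satisfied)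
open import Data.List.Relation.Unary.Unique.Propositional using (Unique)
open import Data.List.Relation.Unary.Unique.Propositional.Properties using (++⁺; upTo⁺; cartesianProductWith⁺)
open import Data.Vec as Vec using (Vec; []; _∷_; lookup; toList; fromList)
import Data.Vec.Properties as Vec
open import Data.Vec.Membership.Propositional.Properties using (∈-lookup; ∈-toList⁺)
open import Data.Product using (Σ; ∃-syntax; _×_; _,_; proj₁; proj₂; uncurry)
open import Data.Sum using (_⊎_; inj₁; inj₂)
open import Data.Empty using (⊥-elim)
open import Function using (case_of_; _∘_)
open import Function.Bundles using (_⇔_; mk⇔; Equivalence)
open import Relation.Binary.Definitions using (tri<; tri≈; tri>)
open import Relation.Binary.PropositionalEquality
open import Relation.Nullary using (¬_; Dec; yes; no; _×-dec_)

module _ {A : Set} where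

  same-members⇒length-≡ : {xs ys : List A} → Unique xs → Unique ys →
                          (∀ {x} → x ∈ xs ⇔ x ∈ ys) → length xs ≡ length ys
  same-members⇒length-≡ xs! ys! xs⇔ys = ↭-length (∼bag⇒↭ (unique∧set⇒bag xs! ys! xs⇔ys))

  concatTo : ℕ → (ℕ → List A) → List A
  concatTo zero    f = f 0
  concatTo (suc n) f = concatTo n f ++ f (suc n)

  ∈-concatTo⁺ : ∀ n (f : ℕ → List A) {x k} → k ≤ n → x ∈ f k → x ∈ concatTo n f
  ∈-concatTo⁺ zero    f z≤n x∈ = x∈
  ∈-concatTo⁺ (suc n) f k≤1+n x∈ with m≤n⇒m<n∨m≡n k≤1+n
  ... | inj₁ k<1+n = ∈-++⁺ˡ (∈-concatTo⁺ n f (≤-pred k<1+n) x∈)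
  ... | inj₂ refl  = ∈-++⁺ʳ (concatTo n f) x∈

  ∈-concatTo⁻ : ∀ n (f : ℕ → List A) {x} → x ∈ concatTo n f → ∃[ k ] k ≤ n × x ∈ f k
  ∈-concatTo⁻ zero    f x∈ = 0 , z≤n , x∈
  ∈-concatTo⁻ (suc n) f x∈ with ∈-++⁻ (concatTo n f) x∈
  ... | inj₁ x∈′ = let k , k≤n , x∈fk = ∈-concatTo⁻ n f x∈′ in k , m≤n⇒m≤1+n k≤n , x∈fk
  ... | inj₂ x∈′ = suc n , ≤-refl , x∈′

  concatTo⁺ : ∀ n (f : ℕ → List A) → (∀ k → Unique (f k)) →
              (∀ {k k′ x} → x ∈ f k → x ∈ f k′ → k ≡ k′) → Unique (concatTo n f)
  concatTo⁺ zero    f f! disjoint = f! 0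
  concatTo⁺ (suc n) f f! disjoint = ++⁺ (concatTo⁺ n f f! disjoint) (f! (suc n)) λ (x∈ , x∈′) →
    let k , k≤n , x∈fk = ∈-concatTo⁻ n f x∈ in 1+n≰n (subst (_≤ n) (disjoint x∈fk x∈′) k≤n)

  +length-concatTo : ∀ n (f : ℕ → List A) →
                     ℤ.+ length (concatTo n f) ≡ sumTo n (λ k → ℤ.+ length (f k))
  +length-concatTo zero    f = refl
  +length-concatTo (suc n) f = begin
    ℤ.+ length (concatTo n f ++ f (suc n))
      ≡⟨ cong ℤ.+_ (length-++ (concatTo n f)) ⟩
    ℤ.+ (length (concatTo n f) + length (f (suc n)))
      ≡⟨ ℤ.pos-+ (length (concatTo n f)) (length (f (suc n))) ⟩
    ℤ.+ length (concatTo n f) ℤ.+ ℤ.+ length (f (suc n))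
      ≡⟨ cong (ℤ._+ ℤ.+ length (f (suc n))) (+length-concatTo n f) ⟩
    sumTo (suc n) (λ k → ℤ.+ length (f k)) ∎
    where open ≡-Reasoning

  take-length-++ : ∀ (xs ys : List A) → take (length xs) (xs ++ ys) ≡ xs
  take-length-++ []       ys = refl
  take-length-++ (x ∷ xs) ys = cong (x ∷_) (take-length-++ xs ys)

  take-length+-++ : ∀ (xs ys : List A) n → take (length xs + n) (xs ++ ys) ≡ xs ++ take n ys
  take-length+-++ []       ys n = refl
  take-length+-++ (x ∷ xs) ys n = cong (x ∷_) (take-length+-++ xs ys n)

  drop-length-++ : ∀ (xs ys : List A) → drop (length xs) (xs ++ ys) ≡ ys
  drop-length-++ []       ys = refl
  drop-length-++ (x ∷ xs) ys = drop-length-++ xs ys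

module _ {A B : Set} where

  map⁺-on : {f : A → B} {xs : List A} → (∀ {x y} → x ∈ xs → y ∈ xs → f x ≡ f y → x ≡ y) →
            Unique xs → Unique (map f xs)
  map⁺-on              f-inj []           = []
  map⁺-on {f} {x ∷ xs} f-inj (x∉xs ∷ xs!) =
    All.map⁺ (All.tabulate fx≢) ∷ map⁺-on (λ x∈ y∈ → f-inj (there x∈) (there y∈)) xs!
    where
    fx≢ : ∀ {y} → y ∈ xs → f x ≢ f y
    fx≢ y∈ fx≡fy = All.lookup x∉xs y∈ (f-inj (here refl) (there y∈) fx≡fy)

module _ {A B C : Set} (f : A → B → C) where

  length-cartesianProductWith : (xs : List A) (ys : List B) →
                                length (cartesianProductWith f xs ys) ≡ length xs * length ys
  length-cartesianProductWith []       ys = refl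
  length-cartesianProductWith (x ∷ xs) ys = begin
    length (map (f x) ys ++ cartesianProductWith f xs ys)
      ≡⟨ length-++ (map (f x) ys) ⟩
    length (map (f x) ys) + length (cartesianProductWith f xs ys)
      ≡⟨ cong₂ _+_ (length-map (f x) ys) (length-cartesianProductWith xs ys) ⟩
    length ys + length xs * length ys ∎
    where open ≡-Reasoning

  cartesianProductWith⁺-on : {xs : List A} {ys : List B} → Unique xs → Unique ys →
    (∀ {a a′ b b′} → a ∈ xs → a′ ∈ xs → b ∈ ys → b′ ∈ ys →
                     f a b ≡ f a′ b′ → a ≡ a′ × b ≡ b′) →
    Unique (cartesianProductWith f xs ys)
  cartesianProductWith⁺-on []              ys! f-inj = []
  cartesianProductWith⁺-on {x ∷ xs} {ys} (x∉xs ∷ xs!) ys! f-inj =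
    ++⁺ (map⁺-on (λ b∈ b′∈ e → proj₂ (f-inj (here refl) (here refl) b∈ b′∈ e)) ys!)
        (cartesianProductWith⁺-on xs! ys! λ a∈ a′∈ → f-inj (there a∈) (there a′∈))
        λ (z∈ , z∈′) → disjoint z∈ z∈′
    where
    disjoint : ∀ {z} → z ∈ map (f x) ys → ¬ z ∈ cartesianProductWith f xs ys
    disjoint z∈ z∈′ with ∈-map⁻ (f x) z∈ | ∈-cartesianProductWith⁻ f xs ys z∈′
    ... | b , b∈ , refl | a , b′ , a∈ , b′∈ , e =
      All.lookup x∉xs a∈ (proj₁ (f-inj (here refl) (there a∈) b∈ b′∈ e))

-- Finite sums and power series

sumTo-cong : ∀ n {f g : ℕ → ℤ} → (∀ k → f k ≡ g k) → sumTo n f ≡ sumTo n g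
sumTo-cong zero    f≡g = f≡g 0
sumTo-cong (suc n) f≡g = cong₂ ℤ._+_ (sumTo-cong n f≡g) (f≡g (suc n))

sumTo-zero : ∀ n {f : ℕ → ℤ} → (∀ k → f k ≡ ℤ.0ℤ) → sumTo n f ≡ ℤ.0ℤ
sumTo-zero zero    f≡0 = f≡0 0
sumTo-zero (suc n) f≡0 = cong₂ ℤ._+_ (sumTo-zero n f≡0) (f≡0 (suc n))

sumTo-head : ∀ n {f : ℕ → ℤ} → (∀ k → f (suc k) ≡ ℤ.0ℤ) → sumTo n f ≡ f 0
sumTo-head zero    f≡0 = refl
sumTo-head (suc n) {f} f≡0 = trans (cong₂ ℤ._+_ (sumTo-head n f≡0) (f≡0 n)) (ℤ.+-identityʳ (f 0))

sumTo-minus : ∀ n (f g : ℕ → ℤ) → sumTo n (λ k → f k ℤ.- g k) ≡ sumTo n f ℤ.- sumTo n g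
sumTo-minus zero    f g = refl
sumTo-minus (suc n) f g = trans (cong (ℤ._+ (f (suc n) ℤ.- g (suc n))) (sumTo-minus n f g))
  (solve 4 (λ a b c d → (a :- b) :+ (c :- d) := (a :+ c) :- (b :+ d)) refl
           (sumTo n f) (sumTo n g) (f (suc n)) (g (suc n)))
  where open ℤ-Solver

*S-distribʳ-minus : ∀ F G H n r → ((F -S G) *S H) n r ≡ (F *S H) n r ℤ.- (G *S H) n r
*S-distribʳ-minus F G H n r = trans
  (sumTo-cong n λ k → trans
    (sumTo-cong r λ i → solve 3 (λ x y z → (x :- y) :* z := x :* z :- y :* z) refl
                                (F k i) (G k i) (H (n ∸ k) (r ∸ i)))
    (sumTo-minus r _ _))
  (sumTo-minus n _ _)
  where open ℤ-Solver

*S-identityˡ : ∀ H n r → (oneS *S H) n r ≡ H n r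
*S-identityˡ H n r = begin
  (oneS *S H) n r                                         ≡⟨ sumTo-head n (λ k → sumTo-zero r λ i → refl) ⟩
  sumTo r (λ i → oneS 0 i ℤ.* H n (r ∸ i))                ≡⟨ sumTo-head r (λ i → refl) ⟩
  ℤ.1ℤ ℤ.* H n r                                          ≡⟨ ℤ.*-identityˡ (H n r) ⟩
  H n r                                                   ∎
  where open ≡-Reasoning

atomicSeries*-zero : ∀ c H r → (atomicSeries c *S H) 0 r ≡ ℤ.0ℤ
atomicSeries*-zero c H r = sumTo-zero r λ i → refl

≤⇒≤ᵇ-true : ∀ {m n} → m ≤ n → (m ≤ᵇ n) ≡ true
≤⇒≤ᵇ-true m≤n = Equivalence.to T-≡ (≤⇒≤ᵇ m≤n)

atomicSeries-≡ : ∀ {c} → (∀ {k i} → 0 < c k i → 1 ≤ k × 1 ≤ i × i ≤ k) →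
                 ∀ k i → atomicSeries c k i ≡ ℤ.+ c k i
atomicSeries-≡ {c} support k i with c k i in c≡
... | zero  = if-eta ((1 ≤ᵇ k) ∧ (1 ≤ᵇ i) ∧ (i ≤ᵇ k))
... | suc _ with support (subst (0 <_) (sym c≡) z<s)
...   | 1≤k , 1≤i , i≤k rewrite ≤⇒≤ᵇ-true 1≤k | ≤⇒≤ᵇ-true 1≤i | ≤⇒≤ᵇ-true i≤k = refl

compSeries-zero : ∀ r → compSeries 0 r ≡ oneS 0 r
compSeries-zero zero    = refl
compSeries-zero (suc r) = cong ℤ.+_ (*-zeroʳ (suc r !))

-- Surjective words

-- These encode the set compositions of [n] with r blocks (see indexWord).
record SurjWord (n r : ℕ) (w : List ℕ) : Set where
  constructor surjWord
  field
    length≡ : length w ≡ n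
    bounded : All (_< r) w
    onto    : ∀ y → y < r → y ∈ w

punchInℕ : ℕ → ℕ → ℕ
punchInℕ x y with y <? x
... | yes _ = y
... | no  _ = suc y

punchOutℕ : ℕ → ℕ → ℕ
punchOutℕ x y with y <? x
... | yes _ = y
... | no  _ = pred y

punchInℕᵢ≢i : ∀ x y → punchInℕ x y ≢ x
punchInℕᵢ≢i x y with y <? x
... | yes y<x = λ y≡x → <-irrefl y≡x y<x
... | no  y≮x = λ 1+y≡x → y≮x (≤-reflexive 1+y≡x)

punchInℕ-injective : ∀ x {y z} → punchInℕ x y ≡ punchInℕ x z → y ≡ z
punchInℕ-injective x {y} {z} e with y <? x | z <? x
... | yes _   | yes _   = e
... | yes y<x | no  z≮x = ⊥-elim (z≮x (<-trans (n<1+n z) (subst (_< x) e y<x)))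
... | no  y≮x | yes z<x = ⊥-elim (y≮x (<-trans (n<1+n y) (subst (_< x) (sym e) z<x)))
... | no  _   | no  _   = suc-injective e

punchInℕ-punchOutℕ : ∀ x {y} → y ≢ x → punchInℕ x (punchOutℕ x y) ≡ y
punchInℕ-punchOutℕ x {y} y≢x with y <? x
punchInℕ-punchOutℕ x {y} y≢x | yes y<x with y <? x
... | yes _   = refl
... | no  y≮x = ⊥-elim (y≮x y<x)
punchInℕ-punchOutℕ x {zero}  y≢x | no y≮x = ⊥-elim (y≢x (sym (n≤0⇒n≡0 (≮⇒≥ y≮x))))
punchInℕ-punchOutℕ x {suc y} y≢x | no y≮x with y <? x
... | yes y<x = ⊥-elim (y≢x (sym (≤-antisym (≮⇒≥ y≮x) y<x)))
... | no  _   = refl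

punchOutℕ-punchInℕ : ∀ x y → punchOutℕ x (punchInℕ x y) ≡ y
punchOutℕ-punchInℕ x y with y <? x
punchOutℕ-punchInℕ x y | yes y<x with y <? x
... | yes _   = refl
... | no  y≮x = ⊥-elim (y≮x y<x)
punchOutℕ-punchInℕ x y | no y≮x with suc y <? x
... | yes 1+y<x = ⊥-elim (y≮x (≤-trans (n≤1+n _) 1+y<x))
... | no  _     = refl

punchInℕ-< : ∀ {x r y} → x < suc r → y < r → punchInℕ x y < suc r
punchInℕ-< {x} {r} {y} x<1+r y<r with y <? x
... | yes _ = m≤n⇒m≤1+n y<r
... | no  _ = s≤s y<r

punchOutℕ-< : ∀ {x r y} → x < suc r → y < suc r → y ≢ x → punchOutℕ x y < r
punchOutℕ-< {x} {r} {y} x<1+r y<1+r y≢x with y <? x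
... | yes y<x = <-≤-trans y<x (≤-pred x<1+r)
punchOutℕ-< {x} {r} {zero}  x<1+r y<1+r y≢x | no y≮x = ⊥-elim (y≢x (sym (n≤0⇒n≡0 (≮⇒≥ y≮x))))
punchOutℕ-< {x} {r} {suc y} x<1+r y<1+r y≢x | no y≮x = ≤-pred y<1+r

-- A surjective word of length 1 + n either reuses its first letter later, or uses it only
-- once, and then the rest is a surjective word on the other r letters, renumbered.
consRepeated consFresh : List ℕ → ℕ → List ℕ
consRepeated w x = x ∷ w
consFresh    w x = x ∷ map (punchInℕ x) w

surjWords : ℕ → ℕ → List (List ℕ)
surjWords zero    zero    = [] ∷ []
surjWords zero    (suc r) = []
surjWords (suc n) zero    = []
surjWords (suc n) (suc r) =
  cartesianProductWith consRepeated (surjWords n (suc r)) (upTo (suc r)) ++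
  cartesianProductWith consFresh (surjWords n r) (upTo (suc r))

length-surjWords : ∀ n r → length (surjWords n r) ≡ r ! * S n r
length-surjWords zero    zero    = refl
length-surjWords zero    (suc r) = sym (*-zeroʳ (suc r !))
length-surjWords (suc n) zero    = refl
length-surjWords (suc n) (suc r) = begin
  length (cartesianProductWith consRepeated (surjWords n (suc r)) (upTo (suc r)) ++
          cartesianProductWith consFresh (surjWords n r) (upTo (suc r)))
    ≡⟨ length-++ (cartesianProductWith consRepeated (surjWords n (suc r)) (upTo (suc r))) ⟩
  length (cartesianProductWith consRepeated (surjWords n (suc r)) (upTo (suc r))) +
  length (cartesianProductWith consFresh (surjWords n r) (upTo (suc r)))
    ≡⟨ cong₂ _+_ (length-cartesianProductWith consRepeated (surjWords n (suc r)) (upTo (suc r)))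
                 (length-cartesianProductWith consFresh (surjWords n r) (upTo (suc r))) ⟩
  length (surjWords n (suc r)) * length (upTo (suc r)) + length (surjWords n r) * length (upTo (suc r))
    ≡⟨ cong₂ _+_ (cong₂ _*_ (length-surjWords n (suc r)) (length-upTo (suc r)))
                 (cong₂ _*_ (length-surjWords n r) (length-upTo (suc r))) ⟩
  (suc r ! * S n (suc r)) * suc r + (r ! * S n r) * suc r
    ≡⟨ solve 4 (λ R F A B → ((R :* F) :* A) :* R :+ (F :* B) :* R := (R :* F) :* (R :* A :+ B))
             refl (suc r) (r !) (S n (suc r)) (S n r) ⟩
  suc r ! * S (suc n) (suc r) ∎
  where
  open ≡-Reasoning
  open +-*-Solver

∈-surjWords⁻ : ∀ n r {w} → w ∈ surjWords n r → SurjWord n r w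
∈-surjWords⁻ zero    zero    (here refl) = surjWord refl [] λ _ ()
∈-surjWords⁻ (suc n) (suc r) w∈
  with ∈-++⁻ (cartesianProductWith consRepeated (surjWords n (suc r)) (upTo (suc r))) w∈
... | inj₁ w∈′ with ∈-cartesianProductWith⁻ consRepeated (surjWords n (suc r)) (upTo (suc r)) w∈′
...   | w , x , w∈ , x∈ , refl =
  surjWord (cong suc length≡) (∈-upTo⁻ x∈ ∷ bounded) λ y y<1+r → there (onto y y<1+r)
  where open SurjWord (∈-surjWords⁻ n (suc r) w∈)
∈-surjWords⁻ (suc n) (suc r) w∈ | inj₂ w∈′
  with ∈-cartesianProductWith⁻ consFresh (surjWords n r) (upTo (suc r)) w∈′
...   | w , x , w∈ , x∈ , refl =
  surjWord (cong suc (trans (length-map (punchInℕ x) w) length≡))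
           (x<1+r ∷ All.map⁺ (All.map (punchInℕ-< x<1+r) bounded))
           onto′
  where
  open SurjWord (∈-surjWords⁻ n r w∈)
  x<1+r = ∈-upTo⁻ x∈
  onto′ : ∀ y → y < suc r → y ∈ x ∷ map (punchInℕ x) w
  onto′ y y<1+r with y ≟ x
  ... | yes refl = here refl
  ... | no  y≢x  = there (subst (_∈ map (punchInℕ x) w) (punchInℕ-punchOutℕ x y≢x)
                     (∈-map⁺ (punchInℕ x) (onto _ (punchOutℕ-< x<1+r y<1+r y≢x))))

∈-surjWords⁺ : ∀ n r {w} → SurjWord n r w → w ∈ surjWords n r
∈-surjWords⁺ zero    zero    {[]}    _ = here refl
∈-surjWords⁺ zero    (suc r) {[]}    sw with SurjWord.onto sw 0 (s≤s z≤n)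
... | ()
∈-surjWords⁺ (suc n) zero    {x ∷ w} (surjWord _ (() ∷ _) _)
∈-surjWords⁺ (suc n) (suc r) {x ∷ w} (surjWord len (x<1+r ∷ bounded) onto) with x ∈? w
... | yes x∈w = ∈-++⁺ˡ (∈-cartesianProductWith⁺ consRepeated
      (∈-surjWords⁺ n (suc r) (surjWord (suc-injective len) bounded onto′)) (∈-upTo⁺ x<1+r))
  where
  onto′ : ∀ y → y < suc r → y ∈ w
  onto′ y y<1+r with onto y y<1+r
  ... | here refl = x∈w
  ... | there y∈w = y∈w
... | no x∉w = ∈-++⁺ʳ (cartesianProductWith consRepeated (surjWords n (suc r)) (upTo (suc r)))
      (subst (λ w → x ∷ w ∈ _) (punchInℕ-punchOutℕ-map w≢x)
        (∈-cartesianProductWith⁺ consFresh (∈-surjWords⁺ n r sw′) (∈-upTo⁺ x<1+r)))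
  where
  w≢x : All (_≢ x) w
  w≢x = All.tabulate λ y∈w y≡x → x∉w (subst (_∈ w) y≡x y∈w)
  punchInℕ-punchOutℕ-map : ∀ {v} → All (_≢ x) v → map (punchInℕ x) (map (punchOutℕ x) v) ≡ v
  punchInℕ-punchOutℕ-map []             = refl
  punchInℕ-punchOutℕ-map (y≢x ∷ v≢x) =
    cong₂ _∷_ (punchInℕ-punchOutℕ x y≢x) (punchInℕ-punchOutℕ-map v≢x)
  sw′ : SurjWord n r (map (punchOutℕ x) w)
  sw′ = surjWord (trans (length-map (punchOutℕ x) w) (suc-injective len))
    (All.map⁺ (All.zipWith (λ (y<1+r , y≢x) → punchOutℕ-< x<1+r y<1+r y≢x) (bounded , w≢x)))
    λ z z<r → case onto (punchInℕ x z) (punchInℕ-< x<1+r z<r) of λ where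
      (here e)  → ⊥-elim (punchInℕᵢ≢i x z e)
      (there m) → subst (_∈ map (punchOutℕ x) w) (punchOutℕ-punchInℕ x z) (∈-map⁺ (punchOutℕ x) m)

surjWords-unique : ∀ n r → Unique (surjWords n r)
surjWords-unique zero    zero    = [] ∷ []
surjWords-unique zero    (suc r) = []
surjWords-unique (suc n) zero    = []
surjWords-unique (suc n) (suc r) =
  ++⁺ (cartesianProductWith⁺ consRepeated repeat-injective (surjWords-unique n (suc r)) (upTo⁺ (suc r)))
      (cartesianProductWith⁺ consFresh fresh-injective (surjWords-unique n r) (upTo⁺ (suc r)))
      λ (v∈ , v∈′) → disjoint v∈ v∈′
  where
  repeat-injective : ∀ {w w′ x x′} → consRepeated w x ≡ consRepeated w′ x′ → w ≡ w′ × x ≡ x′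
  repeat-injective e = let x≡x′ , w≡w′ = ∷-injective e in w≡w′ , x≡x′
  fresh-injective : ∀ {w w′ x x′} → consFresh w x ≡ consFresh w′ x′ → w ≡ w′ × x ≡ x′
  fresh-injective e with ∷-injective e
  ... | refl , e′ = map-injective (punchInℕ-injective _) e′ , refl
  disjoint : ∀ {v} → v ∈ cartesianProductWith consRepeated (surjWords n (suc r)) (upTo (suc r)) →
             ¬ v ∈ cartesianProductWith consFresh (surjWords n r) (upTo (suc r))
  disjoint v∈ v∈′
    with ∈-cartesianProductWith⁻ consRepeated (surjWords n (suc r)) (upTo (suc r)) v∈
       | ∈-cartesianProductWith⁻ consFresh (surjWords n r) (upTo (suc r)) v∈′
  ... | w , x , w∈ , x∈ , refl | w′ , _ , _ , _ , e with ∷-injective e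
  ... | refl , refl with ∈-map⁻ (punchInℕ x) (SurjWord.onto (∈-surjWords⁻ n (suc r) w∈) x (∈-upTo⁻ x∈))
  ... | z , _ , x≡ = punchInℕᵢ≢i x z (sym x≡)

bounded-onto⇒≤ : ∀ {r r′ w} → All (_< r) w → (∀ y → y < r′ → y ∈ w) → r′ ≤ r
bounded-onto⇒≤ {r} {r′} bounded onto with r′ ≤? r
... | yes r′≤r = r′≤r
... | no  r′≰r = ⊥-elim (<-irrefl refl (All.lookup bounded (onto r (≰⇒> r′≰r))))

SurjWord-letters-unique : ∀ {n n′ r r′ w} → SurjWord n r w → SurjWord n′ r′ w → r ≡ r′
SurjWord-letters-unique (surjWord _ bounded onto) (surjWord _ bounded′ onto′) =
  ≤-antisym (bounded-onto⇒≤ bounded′ onto) (bounded-onto⇒≤ bounded onto′)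

S-vanishes : ∀ {n r} → n < r → S n r ≡ 0
S-vanishes {zero}  {suc r} _         = refl
S-vanishes {suc n} {suc r} (s≤s n<r)
  rewrite S-vanishes {n} {suc r} (m<n⇒m<1+n n<r) | S-vanishes n<r = trans (+-identityʳ _) (*-zeroʳ (suc r))

SurjWord⇒r≤n : ∀ {n r w} → SurjWord n r w → r ≤ n
SurjWord⇒r≤n {n} {r} sw with r ≤? n
... | yes r≤n = r≤n
... | no  r≰n with surjWords n r | length-surjWords n r | ∈-surjWords⁺ n r sw
...   | _ ∷ _ | len | _ =
  ⊥-elim (1+n≢0 (trans len (trans (cong (r ! *_) (S-vanishes (≰⇒> r≰n))) (*-zeroʳ (r !)))))

SurjWord⇒0<r : ∀ {n r w} → SurjWord (suc n) r w → 0 < r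
SurjWord⇒0<r {w = x ∷ _} (surjWord _ (x<r ∷ _) _) = <-≤-trans z<s x<r
SurjWord⇒0<r {w = []}    (surjWord () _ _)

-- Unique factorisation into atomic words

m≤n<m+o⇒n∸m<o : ∀ m {n o} → m ≤ n → n < m + o → n ∸ m < o
m≤n<m+o⇒n∸m<o zero    z≤n       n<o       = n<o
m≤n<m+o⇒n∸m<o (suc m) (s≤s m≤n) (s≤s n<o) = m≤n<m+o⇒n∸m<o m m≤n n<o

n<o∸m⇒m+n<o : ∀ m {n o} → n < o ∸ m → m + n < o
n<o∸m⇒m+n<o zero    {o = o}     n<o   = n<o
n<o∸m⇒m+n<o (suc m) {o = suc o} n<o∸m = s≤s (n<o∸m⇒m+n<o m n<o∸m)

m+n<o⇒n<o∸m : ∀ m {n o} → m + n < o → n < o ∸ m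
m+n<o⇒n<o∸m zero    m+n<o              = m+n<o
m+n<o⇒n<o∸m (suc m) {o = suc o} (s≤s m+n<o) = m+n<o⇒n<o∸m m m+n<o

-- The word of Φ|Ψ, when u and v are those of Φ and Ψ and Φ has a blocks.
infixr 5 _∣[_]_

_∣[_]_ : List ℕ → ℕ → List ℕ → List ℕ
u ∣[ a ] v = u ++ map (a +_) v

∣-assoc : ∀ u i b v t → (u ∣[ i ] v) ∣[ i + b ] t ≡ u ∣[ i ] (v ∣[ b ] t)
∣-assoc u i b v t = begin
  (u ++ map (i +_) v) ++ map (i + b +_) t
    ≡⟨ ++-assoc u (map (i +_) v) _ ⟩
  u ++ (map (i +_) v ++ map (i + b +_) t)
    ≡⟨ cong (λ s → u ++ (map (i +_) v ++ s)) (trans (map-cong (+-assoc i b) t) (map-∘ t)) ⟩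
  u ++ (map (i +_) v ++ map (i +_) (map (b +_) t))
    ≡⟨ cong (u ++_) (map-++ (i +_) v (map (b +_) t)) ⟨
  u ∣[ i ] (v ∣[ b ] t) ∎
  where open ≡-Reasoning

SurjWord-∣ : ∀ {j a u m b v} → SurjWord j a u → SurjWord m b v → SurjWord (j + m) (a + b) (u ∣[ a ] v)
SurjWord-∣ {j} {a} {u} {m} {b} {v} (surjWord lu bu ou) (surjWord lv bv ov) = surjWord
  (trans (length-++ u) (cong₂ _+_ lu (trans (length-map (a +_) v) lv)))
  (All.++⁺ (All.map (λ y<a → <-≤-trans y<a (m≤m+n a b)) bu) (All.map⁺ (All.map (+-monoʳ-< a) bv)))
  onto
  where
  onto : ∀ y → y < a + b → y ∈ u ∣[ a ] v
  onto y y<a+b with y <? a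
  ... | yes y<a = ∈-++⁺ˡ (ou y y<a)
  ... | no  y≮a = ∈-++⁺ʳ u (subst (_∈ map (a +_) v) (m+[n∸m]≡n (≮⇒≥ y≮a))
                    (∈-map⁺ (a +_) (ov (y ∸ a) (m≤n<m+o⇒n∸m<o a (≮⇒≥ y≮a) y<a+b))))

record Splitting (k : ℕ) (w : List ℕ) : Set where
  constructor splitting
  field
    {j m a b}    : ℕ
    {left right} : List ℕ
    0<j          : 0 < j
    0<m          : 0 < m
    j+m≡k        : j + m ≡ k
    left-surj    : SurjWord j a left
    right-surj   : SurjWord m b right
    w≡           : left ∣[ a ] right ≡ w

record AtomicWord (k : ℕ) (w : List ℕ) : Set where
  constructor atomicWord
  field
    nonempty    : 1 ≤ k
    irreducible : ¬ Splitting k w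

-- The prefix of length j splits off exactly when its letters are all below those of the rest.
SplitsAt : ℕ → List ℕ → Set
SplitsAt j w = All (λ y → All (y <_) (drop j w)) (take j w)

SplitsAt? : ∀ j w → Dec (SplitsAt j w)
SplitsAt? j w = All.all? (λ y → All.all? (y <?_) (drop j w)) (take j w)

SplitsAt-∣ : ∀ {u a} v → All (_< a) u → SplitsAt (length u) (u ∣[ a ] v)
SplitsAt-∣ {u} {a} v u<a rewrite take-length-++ u (map (a +_) v) | drop-length-++ u (map (a +_) v) =
  All.map (λ y<a → All.map⁺ (All.tabulate λ {z} _ → <-≤-trans y<a (m≤m+n a z))) u<a

bound : List ℕ → ℕ
bound u = max 0 (map suc u)

bound-bounds : ∀ u → All (_< bound u) u
bound-bounds u = All.map⁻ (xs≤max 0 (map suc u))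

bound-least : ∀ {u z} → All (_< z) u → bound u ≤ z
bound-least u<z = max≤v⁺ z≤n (All.map⁺ u<z)

-- At a split point the prefix uses exactly the letters below its bound a, and the suffix
-- the letters from a on, which are renumbered down by a.
cut : ∀ {n r w j} → SurjWord n r w → j ≤ n → SplitsAt j w →
      Σ ℕ λ a → Σ (List ℕ) λ v →
        SurjWord j a (take j w) × SurjWord (n ∸ j) (r ∸ a) v × a ≤ r × take j w ∣[ a ] v ≡ w
cut {n} {r} {w} {j} (surjWord len bounded onto) j≤n splits =
  a , map (_∸ a) rest ,
  surjWord (trans (length-take j w) (m≤n⇒m⊓n≡m (subst (j ≤_) (sym len) j≤n))) (bound-bounds u) onto-u ,
  surjWord (trans (length-map (_∸ a) rest) (trans (length-drop j w) (cong (_∸ j) len))) bounded-v onto-v ,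
  a≤r ,
  trans (cong (u ++_) (trans (sym (map-∘ rest)) (map-id-local (All.tabulate λ z∈ → m+[n∸m]≡n (a≤rest z∈)))))
        (take++drop≡id j w)
  where
  u = take j w
  rest = drop j w
  a = bound u
  a≤r : a ≤ r
  a≤r = bound-least (All.take⁺ j bounded)
  a≤rest : ∀ {z} → z ∈ rest → a ≤ z
  a≤rest z∈ = bound-least (All.map (λ y<rest → All.lookup y<rest z∈) splits)
  ∈-u++rest : ∀ {y} → y ∈ w → y ∈ u ⊎ y ∈ rest
  ∈-u++rest y∈ = ∈-++⁻ u (subst (_ ∈_) (sym (take++drop≡id j w)) y∈)
  onto-u : ∀ y → y < a → y ∈ u
  onto-u y y<a with ∈-u++rest (onto y (<-≤-trans y<a a≤r))
  ... | inj₁ y∈u    = y∈u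
  ... | inj₂ y∈rest = ⊥-elim (<⇒≱ y<a (a≤rest y∈rest))
  bounded-v : All (_< r ∸ a) (map (_∸ a) rest)
  bounded-v = All.map⁺ (All.tabulate λ z∈ → ∸-monoˡ-< (All.lookup (All.drop⁺ j bounded) z∈) (a≤rest z∈))
  onto-v : ∀ y → y < r ∸ a → y ∈ map (_∸ a) rest
  onto-v y y<r∸a with ∈-u++rest (onto (a + y) (n<o∸m⇒m+n<o a y<r∸a))
  ... | inj₁ a+y∈u    = ⊥-elim (<⇒≱ (All.lookup (bound-bounds u) a+y∈u) (m≤m+n a y))
  ... | inj₂ a+y∈rest = subst (_∈ map (_∸ a) rest) (m+n∸m≡n a y) (∈-map⁺ (_∸ a) a+y∈rest)

record Factorisation (n r : ℕ) (w : List ℕ) : Set where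
  constructor factorisation
  field
    {k i m b}   : ℕ
    {atom rest} : List ℕ
    atom-surj   : SurjWord k i atom
    atom-atomic : AtomicWord k atom
    rest-surj   : SurjWord m b rest
    k+m≡n       : k + m ≡ n
    i+b≡r       : i + b ≡ r
    w≡          : w ≡ atom ∣[ i ] rest

Factorisation-∣ : ∀ {j a u m′ b′ v} → Factorisation j a u → SurjWord m′ b′ v →
                  Factorisation (j + m′) (a + b′) (u ∣[ a ] v)
Factorisation-∣ {v = v} (factorisation {k} {i} {m} {b} {atom} {rest} atom-surj atomic rest-surj refl refl refl) v-surj =
  factorisation atom-surj atomic (SurjWord-∣ rest-surj v-surj)
    (sym (+-assoc k m _)) (sym (+-assoc i b _)) (∣-assoc atom i b rest v)

factorise : ∀ n {r w} → 1 ≤ n → SurjWord n r w → Factorisation n r w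
factorise = <-rec Factorisable step
  where
  Factorisable : ℕ → Set
  Factorisable n = ∀ {r w} → 1 ≤ n → SurjWord n r w → Factorisation n r w
  step : ∀ n → (∀ {j} → j < n → Factorisable j) → Factorisable n
  step n rec {r} {w} 1≤n sw with any? (λ j → 0 <? j ×-dec j <? n ×-dec SplitsAt? j w) (upTo n)
  ... | yes ∃j with satisfied ∃j
  ...   | j , 0<j , j<n , splits with cut sw (<⇒≤ j<n) splits
  ...     | a , v , u-surj , v-surj , a≤r , u∣v≡w =
    subst₂ (λ n′ r′ → Factorisation n′ r′ w) (m+[n∸m]≡n (<⇒≤ j<n)) (m+[n∸m]≡n a≤r)
      (subst (Factorisation _ _) u∣v≡w (Factorisation-∣ (rec j<n 0<j u-surj) v-surj))
  step n rec {r} {w} 1≤n sw | no ∄j =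
    factorisation sw (atomicWord 1≤n irreducible) (surjWord refl [] λ _ ()) (+-identityʳ n) (+-identityʳ r)
      (sym (++-identityʳ w))
    where
    irreducible : ¬ Splitting n w
    irreducible (splitting {j} {m} {a} {right = v} 0<j 0<m j+m≡n u-surj _ u∣v≡w) =
      ∄j (lose (∈-upTo⁺ j<n) (0<j , j<n , subst₂ SplitsAt (SurjWord.length≡ u-surj) u∣v≡w
                                           (SplitsAt-∣ v (SurjWord.bounded u-surj))))
      where
      j<n : j < n
      j<n = subst (j <_) j+m≡n (m<m+n j 0<m)

longer-prefix-splits : ∀ {k i u v k′ i′ u′ v′} → SurjWord k i u → 1 ≤ k →
                       SurjWord k′ i′ u′ → k < k′ → u ∣[ i ] v ≡ u′ ∣[ i′ ] v′ → Splitting k′ u′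
longer-prefix-splits {k} {i} {u} {v} {k′} {i′} {u′} {v′}
                     u-surj 1≤k (surjWord len′ bounded′ onto′) k<k′ e =
  splitting 1≤k (m<n⇒0<n∸m k<k′) (m+[n∸m]≡n (<⇒≤ k<k′)) u-surj
    (surjWord length-t bounded-t onto-t) (sym u′≡)
  where
  open SurjWord u-surj
  open ≡-Reasoning
  t = take (k′ ∸ k) v
  length-prefix : length u + (k′ ∸ k) ≡ length u′
  length-prefix = trans (cong (_+ (k′ ∸ k)) length≡) (trans (m+[n∸m]≡n (<⇒≤ k<k′)) (sym len′))
  u′≡ : u′ ≡ u ∣[ i ] t
  u′≡ = begin
    u′                                                ≡⟨ take-length-++ u′ (map (i′ +_) v′) ⟨
    take (length u′) (u′ ∣[ i′ ] v′)                  ≡⟨ cong₂ take length-prefix e ⟨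
    take (length u + (k′ ∸ k)) (u ++ map (i +_) v)    ≡⟨ take-length+-++ u (map (i +_) v) (k′ ∸ k) ⟩
    u ++ take (k′ ∸ k) (map (i +_) v)                 ≡⟨ cong (u ++_) (take-map (k′ ∸ k) v) ⟩
    u ∣[ i ] t ∎
  length-t : length t ≡ k′ ∸ k
  length-t = sym (begin
    k′ ∸ k                            ≡⟨ cong (_∸ k) (trans (sym len′) (cong length u′≡)) ⟩
    length (u ∣[ i ] t) ∸ k           ≡⟨ cong (_∸ k) (trans (length-++ u)
                                             (cong₂ _+_ length≡ (length-map (i +_) t))) ⟩
    k + length t ∸ k                  ≡⟨ m+n∸m≡n k (length t) ⟩
    length t ∎)
  i+t⊆u′ : ∀ {z} → z ∈ t → i + z ∈ u′
  i+t⊆u′ z∈t = subst (_ ∈_) (sym u′≡) (∈-++⁺ʳ u (∈-map⁺ (i +_) z∈t))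
  bounded-t : All (_< i′ ∸ i) t
  bounded-t = All.tabulate λ z∈t → m+n<o⇒n<o∸m i (All.lookup bounded′ (i+t⊆u′ z∈t))
  onto-t : ∀ y → y < i′ ∸ i → y ∈ t
  onto-t y y<i′∸i with ∈-++⁻ u (subst (_ ∈_) u′≡ (onto′ (i + y) (n<o∸m⇒m+n<o i y<i′∸i)))
  ... | inj₁ i+y∈u   = ⊥-elim (<⇒≱ (All.lookup bounded i+y∈u) (m≤m+n i y))
  ... | inj₂ i+y∈i+t with ∈-map⁻ (i +_) i+y∈i+t
  ...   | z , z∈t , i+y≡i+z = subst (_∈ t) (sym (+-cancelˡ-≡ i y z i+y≡i+z)) z∈t

atomic-prefix-unique : ∀ {k i u v k′ i′ u′ v′} →
                       SurjWord k i u → AtomicWord k u → SurjWord k′ i′ u′ → AtomicWord k′ u′ →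
                       u ∣[ i ] v ≡ u′ ∣[ i′ ] v′ → k ≡ k′ × i ≡ i′ × u ≡ u′ × v ≡ v′
atomic-prefix-unique {k} {i} {u} {v} {k′} {i′} {u′} {v′} u-surj u-atomic u′-surj u′-atomic e with <-cmp k k′
... | tri< k<k′ _ _ = ⊥-elim (AtomicWord.irreducible u′-atomic
                        (longer-prefix-splits u-surj (AtomicWord.nonempty u-atomic) u′-surj k<k′ e))
... | tri> _ _ k>k′ = ⊥-elim (AtomicWord.irreducible u-atomic
                        (longer-prefix-splits u′-surj (AtomicWord.nonempty u′-atomic) u-surj k>k′ (sym e)))
... | tri≈ _ refl _ = refl , i≡i′ , u≡u′ , v≡v′
  where
  u≡u′ : u ≡ u′
  u≡u′ = begin
    u                                    ≡⟨ take-length-++ u (map (i +_) v) ⟨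
    take (length u) (u ∣[ i ] v)         ≡⟨ cong₂ take (trans (SurjWord.length≡ u-surj)
                                                               (sym (SurjWord.length≡ u′-surj))) e ⟩
    take (length u′) (u′ ∣[ i′ ] v′)     ≡⟨ take-length-++ u′ (map (i′ +_) v′) ⟩
    u′ ∎
    where open ≡-Reasoning
  i≡i′ : i ≡ i′
  i≡i′ = SurjWord-letters-unique (subst (SurjWord k i) u≡u′ u-surj) u′-surj
  v≡v′ : v ≡ v′
  v≡v′ = map-injective (+-cancelˡ-≡ i _ _)
    (++-cancelˡ u _ _ (trans e (cong₂ (λ s a → s ∣[ a ] v′) (sym u≡u′) (sym i≡i′))))

AtomicWord-support : ∀ {k i u} → SurjWord k i u → AtomicWord k u → 1 ≤ k × 1 ≤ i × i ≤ k
AtomicWord-support u-surj (atomicWord 1≤k@(s≤s z≤n) _) = 1≤k , SurjWord⇒0<r u-surj , SurjWord⇒r≤n u-surj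

module Factorisations
  (atoms        : ℕ → ℕ → List (List ℕ))
  (atoms-unique : ∀ k i → Unique (atoms k i))
  (∈-atoms⁻     : ∀ {k i u} → u ∈ atoms k i → SurjWord k i u × AtomicWord k u)
  (∈-atoms⁺     : ∀ {k i u} → SurjWord k i u → AtomicWord k u → u ∈ atoms k i)
  where

  block : ℕ → ℕ → ℕ → ℕ → List (List ℕ)
  block n r k i = cartesianProductWith (λ u v → u ∣[ i ] v) (atoms k i) (surjWords (n ∸ k) (r ∸ i))

  factorisations : ℕ → ℕ → List (List ℕ)
  factorisations n r = concatTo n λ k → concatTo r λ i → block n r k i

  ∈-block⁻ : ∀ {n r k i x} → x ∈ block n r k i →
             ∃[ u ] ∃[ v ] u ∈ atoms k i × v ∈ surjWords (n ∸ k) (r ∸ i) × x ≡ u ∣[ i ] v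
  ∈-block⁻ {n} {r} {k} {i} = ∈-cartesianProductWith⁻ _ (atoms k i) (surjWords (n ∸ k) (r ∸ i))

  block-indices-unique : ∀ {n r k i k′ i′ x} → x ∈ block n r k i → x ∈ block n r k′ i′ →
                         k ≡ k′ × i ≡ i′
  block-indices-unique x∈ x∈′ with ∈-block⁻ x∈ | ∈-block⁻ x∈′
  ... | u , v , u∈ , _ , refl | u′ , v′ , u′∈ , _ , e =
    let u-surj  , u-atomic  = ∈-atoms⁻ u∈
        u′-surj , u′-atomic = ∈-atoms⁻ u′∈
        k≡k′ , i≡i′ , _ = atomic-prefix-unique u-surj u-atomic u′-surj u′-atomic e
    in k≡k′ , i≡i′

  block-unique : ∀ n r k i → Unique (block n r k i)
  block-unique n r k i = cartesianProductWith⁺-on _ (atoms-unique k i) (surjWords-unique (n ∸ k) (r ∸ i))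
    λ u∈ u′∈ _ _ e →
      let u-surj  , u-atomic  = ∈-atoms⁻ u∈
          u′-surj , u′-atomic = ∈-atoms⁻ u′∈
          _ , _ , u≡u′ , v≡v′ = atomic-prefix-unique u-surj u-atomic u′-surj u′-atomic e
      in u≡u′ , v≡v′

  factorisations-unique : ∀ n r → Unique (factorisations n r)
  factorisations-unique n r =
    concatTo⁺ n _ (λ k → concatTo⁺ r _ (block-unique n r k)
                           λ x∈ x∈′ → proj₂ (block-indices-unique x∈ x∈′))
      λ x∈ x∈′ →
        let i  , _ , x∈block  = ∈-concatTo⁻ r _ x∈
            i′ , _ , x∈block′ = ∈-concatTo⁻ r _ x∈′
        in proj₁ (block-indices-unique x∈block x∈block′)

  ∈-factorisations⁻ : ∀ n r {x} → x ∈ factorisations n r → SurjWord n r x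
  ∈-factorisations⁻ n r x∈ with ∈-concatTo⁻ n _ x∈
  ... | k , k≤n , x∈′ with ∈-concatTo⁻ r _ x∈′
  ...   | i , i≤r , x∈block with ∈-block⁻ x∈block
  ...     | u , v , u∈ , v∈ , refl =
    subst₂ (λ n′ r′ → SurjWord n′ r′ (u ∣[ i ] v)) (m+[n∸m]≡n k≤n) (m+[n∸m]≡n i≤r)
      (SurjWord-∣ (proj₁ (∈-atoms⁻ u∈)) (∈-surjWords⁻ (n ∸ k) (r ∸ i) v∈))

  ∈-factorisations⁺ : ∀ n r {x} → 1 ≤ n → SurjWord n r x → x ∈ factorisations n r
  ∈-factorisations⁺ n r 1≤n x-surj with factorise n 1≤n x-surj
  ... | factorisation {k} {i} {m} {b} {u} {v} u-surj u-atomic v-surj refl refl refl =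
    ∈-concatTo⁺ (k + m) _ (m≤m+n k m) (∈-concatTo⁺ (i + b) _ (m≤m+n i b)
      (∈-cartesianProductWith⁺ _ (∈-atoms⁺ u-surj u-atomic)
        (subst₂ (λ m′ b′ → v ∈ surjWords m′ b′) (sym (m+n∸m≡n k m)) (sym (m+n∸m≡n i b))
          (∈-surjWords⁺ m b v-surj))))

  length-factorisations : ∀ n r → 1 ≤ n → length (factorisations n r) ≡ r ! * S n r
  length-factorisations n r 1≤n = trans
    (same-members⇒length-≡ (factorisations-unique n r) (surjWords-unique n r)
      (mk⇔ (λ x∈ → ∈-surjWords⁺ n r (∈-factorisations⁻ n r x∈))
           (λ x∈ → ∈-factorisations⁺ n r 1≤n (∈-surjWords⁻ n r x∈))))
    (length-surjWords n r)

  +length-factorisations : ∀ n r →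
    ℤ.+ length (factorisations n r) ≡
    sumTo n λ k → sumTo r λ i → ℤ.+ length (atoms k i) ℤ.* compSeries (n ∸ k) (r ∸ i)
  +length-factorisations n r = trans (+length-concatTo n _) (sumTo-cong n λ k →
    trans (+length-concatTo r _) (sumTo-cong r λ i → begin
      ℤ.+ length (block n r k i)
        ≡⟨ cong ℤ.+_ (length-cartesianProductWith _ (atoms k i) (surjWords (n ∸ k) (r ∸ i))) ⟩
      ℤ.+ (length (atoms k i) * length (surjWords (n ∸ k) (r ∸ i)))
        ≡⟨ cong (λ l → ℤ.+ (length (atoms k i) * l)) (length-surjWords (n ∸ k) (r ∸ i)) ⟩
      ℤ.+ (length (atoms k i) * ((r ∸ i) ! * S (n ∸ k) (r ∸ i)))
        ≡⟨ ℤ.pos-* (length (atoms k i)) _ ⟩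
      ℤ.+ length (atoms k i) ℤ.* compSeries (n ∸ k) (r ∸ i) ∎))
    where open ≡-Reasoning

-- Set compositions as surjective words

upToᵥ : (i : ℕ) → Vec ℕ i
upToᵥ zero    = []
upToᵥ (suc i) = 0 ∷ Vec.map suc (upToᵥ i)

lookup-upToᵥ : ∀ {i} (f : Fin i) → lookup (upToᵥ i) f ≡ toℕ f
lookup-upToᵥ {suc i} zero    = refl
lookup-upToᵥ {suc i} (suc f) = trans (Vec.lookup-map f suc (upToᵥ i)) (cong suc (lookup-upToᵥ f))

upToᵥ-+ : ∀ a b → upToᵥ (a + b) ≡ upToᵥ a Vec.++ Vec.map (a +_) (upToᵥ b)
upToᵥ-+ zero    b = sym (Vec.map-id (upToᵥ b))
upToᵥ-+ (suc a) b = cong (0 ∷_) (begin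
  Vec.map suc (upToᵥ (a + b))
    ≡⟨ cong (Vec.map suc) (upToᵥ-+ a b) ⟩
  Vec.map suc (upToᵥ a Vec.++ Vec.map (a +_) (upToᵥ b))
    ≡⟨ Vec.map-++ suc (upToᵥ a) _ ⟩
  Vec.map suc (upToᵥ a) Vec.++ Vec.map suc (Vec.map (a +_) (upToᵥ b))
    ≡⟨ cong (Vec.map suc (upToᵥ a) Vec.++_) (Vec.map-∘ suc (a +_) (upToᵥ b)) ⟨
  Vec.map suc (upToᵥ a) Vec.++ Vec.map (suc a +_) (upToᵥ b) ∎)
  where open ≡-Reasoning

lookup-ext : ∀ {A : Set} {n} {u v : Vec A n} → (∀ f → lookup u f ≡ lookup v f) → u ≡ v
lookup-ext {u = u} {v} u≗v =
  trans (sym (Vec.tabulate∘lookup u)) (trans (Vec.tabulate-cong u≗v) (Vec.tabulate∘lookup v))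

∈-toList⇒lookup : ∀ {A : Set} {n} (w : Vec A n) {y} → y ∈ toList w → ∃[ x ] lookup w x ≡ y
∈-toList⇒lookup (z ∷ w) (here y≡z) = zero , sym y≡z
∈-toList⇒lookup (z ∷ w) (there y∈) = let x , e = ∈-toList⇒lookup w y∈ in suc x , e

lookup∈toList : ∀ {A : Set} {n} (w : Vec A n) x → lookup w x ∈ toList w
lookup∈toList w x = ∈-toList⁺ (∈-lookup x w)

≡ᵇ-true⇔≡ : ∀ {y z} → (y ≡ᵇ z) ≡ true ⇔ y ≡ z
≡ᵇ-true⇔≡ {y} {z} =
  mk⇔ (λ e → ≡ᵇ⇒≡ y z (Equivalence.from T-≡ e)) (λ e → Equivalence.to T-≡ (≡⇒≡ᵇ y z e))

fibre : ∀ {k} → Vec ℕ k → ℕ → Subset k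
fibre w y = Vec.map (_≡ᵇ y) w

fibres : ∀ {k} (i : ℕ) → Vec ℕ k → Vec (Subset k) i
fibres i w = Vec.map (fibre w) (upToᵥ i)

lookup-fibres : ∀ {k i} (w : Vec ℕ k) (f : Fin i) → lookup (fibres i w) f ≡ fibre w (toℕ f)
lookup-fibres {i = i} w f = trans (Vec.lookup-map f _ (upToᵥ i)) (cong (fibre w) (lookup-upToᵥ f))

∈-fibres⇔ : ∀ {k i} (w : Vec ℕ k) {x : Fin k} {f : Fin i} →
            x ∈ₛ lookup (fibres i w) f ⇔ lookup w x ≡ toℕ f
∈-fibres⇔ {i = i} w {x} {f} = mk⇔
  (λ x∈ → Equivalence.to ≡ᵇ-true⇔≡ (trans (sym (lookup-fibre x)) (Vec.[]=⇒lookup x∈)))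
  (λ e → Vec.lookup⇒[]= x _ (trans (lookup-fibre x) (Equivalence.from ≡ᵇ-true⇔≡ e)))
  where
  lookup-fibre : ∀ x → lookup (lookup (fibres i w) f) x ≡ (lookup w x ≡ᵇ toℕ f)
  lookup-fibre x = trans (cong (λ p → lookup p x) (lookup-fibres w f)) (Vec.lookup-map x _ w)

-- Each element is sent to the index of the first block containing it (to i if there is none).
consIndex : Bool → ℕ → ℕ
consIndex x∈p y = if x∈p then 0 else suc y

indexWord : ∀ {k i} → Vec (Subset k) i → Vec ℕ k
indexWord {k} []      = Vec.replicate k 0
indexWord     (p ∷ Φ) = Vec.zipWith consIndex p (indexWord Φ)

lookup-indexWord : ∀ {k i} (Φ : Vec (Subset k) i) {x : Fin k} {f : Fin i} → x ∈ₛ lookup Φ f →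
                   (∀ f′ → x ∈ₛ lookup Φ f′ → f′ ≡ f) → lookup (indexWord Φ) x ≡ toℕ f
lookup-indexWord (p ∷ Φ) {x} {zero} x∈ first
  rewrite Vec.lookup-zipWith consIndex x p (indexWord Φ) | Vec.[]=⇒lookup x∈ = refl
lookup-indexWord (p ∷ Φ) {x} {suc f} x∈ first
  rewrite Vec.lookup-zipWith consIndex x p (indexWord Φ) with lookup p x in x∈p?
... | true  = case first zero (Vec.lookup⇒[]= x p x∈p?) of λ ()
... | false = cong suc (lookup-indexWord Φ x∈ λ f′ x∈′ → Fin.suc-injective (first (suc f′) x∈′))

module _ {k i} (Φ : Vec (Subset k) i) (Φ-comp : IsSetComp Φ) where
  private
    nonempty = proj₁ Φ-comp
    disjoint = proj₁ (proj₂ Φ-comp)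
    covers   = proj₂ (proj₂ Φ-comp)

  block-of-unique : ∀ {x f f′} → x ∈ₛ lookup Φ f → x ∈ₛ lookup Φ f′ → f′ ≡ f
  block-of-unique {x} {f} {f′} x∈ x∈′ with f′ Fin.≟ f
  ... | yes f′≡f = f′≡f
  ... | no  f′≢f = ⊥-elim (disjoint f′ f f′≢f x x∈′ x∈)

  indexWord-∈ : ∀ {x f} → x ∈ₛ lookup Φ f → lookup (indexWord Φ) x ≡ toℕ f
  indexWord-∈ x∈ = lookup-indexWord Φ x∈ λ _ → block-of-unique x∈

  ∈-indexWord : ∀ {x f} → lookup (indexWord Φ) x ≡ toℕ f → x ∈ₛ lookup Φ f
  ∈-indexWord {x} e with covers x
  ... | f′ , x∈ = subst (λ g → x ∈ₛ lookup Φ g) (Fin.toℕ-injective (trans (sym (indexWord-∈ x∈)) e)) x∈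

  fibres-indexWord : fibres i (indexWord Φ) ≡ Φ
  fibres-indexWord = lookup-ext λ f → ⊆-antisym
    (λ x∈ → ∈-indexWord (Equivalence.to (∈-fibres⇔ (indexWord Φ)) x∈))
    (λ x∈ → Equivalence.from (∈-fibres⇔ (indexWord Φ)) (indexWord-∈ x∈))

  SurjWord-indexWord : SurjWord k i (toList (indexWord Φ))
  SurjWord-indexWord = surjWord (Vec.length-toList (indexWord Φ))
    (All.tabulate λ y∈ → let x , x↦y = ∈-toList⇒lookup (indexWord Φ) y∈ ; f , x∈ = covers x in
                          subst (_< i) (trans (sym (indexWord-∈ x∈)) x↦y) (Fin.toℕ<n f))
    λ y y<i → let x , x∈ = nonempty (fromℕ< y<i) in
              subst (_∈ toList (indexWord Φ)) (trans (indexWord-∈ x∈) (Fin.toℕ-fromℕ< y<i))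
                (lookup∈toList (indexWord Φ) x)

SurjWord-fromList : ∀ {n i u} → SurjWord n i u → SurjWord n i (toList (fromList u))
SurjWord-fromList {u = u} = subst (SurjWord _ _) (sym (Vec.toList∘fromList u))

module _ {k i} (w : Vec ℕ k) (w-surj : SurjWord k i (toList w)) where
  private
    lookup-w< : ∀ x → lookup w x < i
    lookup-w< x = All.lookup (SurjWord.bounded w-surj) (lookup∈toList w x)

    ∈-fibre-of : ∀ x → x ∈ₛ lookup (fibres i w) (fromℕ< (lookup-w< x))
    ∈-fibre-of x = Equivalence.from (∈-fibres⇔ w) (sym (Fin.toℕ-fromℕ< (lookup-w< x)))

  fibres-IsSetComp : IsSetComp (fibres i w)
  fibres-IsSetComp =
    (λ f → let x , x↦f = ∈-toList⇒lookup w (SurjWord.onto w-surj (toℕ f) (Fin.toℕ<n f)) in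
           x , Equivalence.from (∈-fibres⇔ w) x↦f) ,
    (λ f f′ f≢f′ x x∈ x∈′ → f≢f′ (Fin.toℕ-injective
      (trans (sym (Equivalence.to (∈-fibres⇔ w) x∈)) (Equivalence.to (∈-fibres⇔ w) x∈′)))) ,
    λ x → fromℕ< (lookup-w< x) , ∈-fibre-of x

  indexWord-fibres : indexWord (fibres i w) ≡ w
  indexWord-fibres = lookup-ext λ x →
    trans (lookup-indexWord (fibres i w) (∈-fibre-of x) λ f′ x∈′ → Fin.toℕ-injective
            (trans (sym (Equivalence.to (∈-fibres⇔ w) x∈′)) (sym (Fin.toℕ-fromℕ< (lookup-w< x)))))
          (Fin.toℕ-fromℕ< (lookup-w< x))

fibre-absent : ∀ {k} (w : Vec ℕ k) {y} → (∀ x → lookup w x ≢ y) → fibre w y ≡ Vec.replicate k false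
fibre-absent w {y} w≢y = lookup-ext λ x → begin
  lookup (fibre w y) x                 ≡⟨ Vec.lookup-map x _ w ⟩
  (lookup w x ≡ᵇ y)                    ≡⟨ ¬-not (λ e → w≢y x (Equivalence.to ≡ᵇ-true⇔≡ e)) ⟩
  false                                ≡⟨ Vec.lookup-replicate x false ⟨
  lookup (Vec.replicate _ false) x     ∎
  where open ≡-Reasoning

+-≡ᵇ-cancelˡ : ∀ a y t → (a + y ≡ᵇ a + t) ≡ (y ≡ᵇ t)
+-≡ᵇ-cancelˡ zero    y t = refl
+-≡ᵇ-cancelˡ (suc a) y t = +-≡ᵇ-cancelˡ a y t

fibre-shift : ∀ {m} a (v : Vec ℕ m) t → fibre (Vec.map (a +_) v) (a + t) ≡ fibre v t
fibre-shift a v t = trans (sym (Vec.map-∘ _ (a +_) v)) (Vec.map-cong (λ z → +-≡ᵇ-cancelˡ a z t) v)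

map-upToᵥ-cong : ∀ {B : Set} a {f g : ℕ → B} → (∀ y → y < a → f y ≡ g y) →
                 Vec.map f (upToᵥ a) ≡ Vec.map g (upToᵥ a)
map-upToᵥ-cong zero    f≡g = refl
map-upToᵥ-cong (suc a) {f} {g} f≡g = cong₂ _∷_ (f≡g 0 z<s) (begin
  Vec.map f (Vec.map suc (upToᵥ a))   ≡⟨ Vec.map-∘ f suc (upToᵥ a) ⟨
  Vec.map (f ∘ suc) (upToᵥ a)         ≡⟨ map-upToᵥ-cong a (λ y y<a → f≡g (suc y) (s≤s y<a)) ⟩
  Vec.map (g ∘ suc) (upToᵥ a)         ≡⟨ Vec.map-∘ g suc (upToᵥ a) ⟩
  Vec.map g (Vec.map suc (upToᵥ a))   ∎)
  where open ≡-Reasoning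

fibres-∣ : ∀ {j m a b} (u : Vec ℕ j) (v : Vec ℕ m) → All (_< a) (toList u) →
           fibres a u ∣∣ fibres b v ≡ fibres (a + b) (u Vec.++ Vec.map (a +_) v)
fibres-∣ {j} {m} {a} {b} u v u<a = begin
  fibres a u ∣∣ fibres b v
    ≡⟨ cong₂ Vec._++_ (trans (sym (Vec.map-∘ _ (fibre u) (upToᵥ a))) (map-upToᵥ-cong a low))
                      (trans (sym (Vec.map-∘ _ (fibre v) (upToᵥ b)))
                             (trans (Vec.map-cong high (upToᵥ b)) (Vec.map-∘ (fibre uv) (a +_) (upToᵥ b)))) ⟩
  Vec.map (fibre uv) (upToᵥ a) Vec.++ Vec.map (fibre uv) (Vec.map (a +_) (upToᵥ b))
    ≡⟨ Vec.map-++ (fibre uv) (upToᵥ a) _ ⟨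
  Vec.map (fibre uv) (upToᵥ a Vec.++ Vec.map (a +_) (upToᵥ b))
    ≡⟨ cong (Vec.map (fibre uv)) (upToᵥ-+ a b) ⟨
  fibres (a + b) uv ∎
  where
  open ≡-Reasoning
  uv = u Vec.++ Vec.map (a +_) v
  low : ∀ y → y < a → fibre u y Vec.++ Vec.replicate m false ≡ fibre uv y
  low y y<a = sym (trans (Vec.map-++ (_≡ᵇ y) u _) (cong (fibre u y Vec.++_) (fibre-absent (Vec.map (a +_) v)
    λ x a+vx≡y → <⇒≱ y<a (≤-trans (m≤m+n a (lookup v x))
                                    (≤-reflexive (trans (sym (Vec.lookup-map x (a +_) v)) a+vx≡y))))))
  high : ∀ t → Vec.replicate j false Vec.++ fibre v t ≡ fibre uv (a + t)
  high t = sym (trans (Vec.map-++ (_≡ᵇ (a + t)) u _) (cong₂ Vec._++_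
    (fibre-absent u λ x ux≡a+t → <⇒≱ (All.lookup u<a (lookup∈toList u x))
                                      (≤-trans (m≤m+n a t) (≤-reflexive (sym ux≡a+t))))
    (fibre-shift a v t)))

toList-injective : ∀ {A : Set} {n} (u v : Vec A n) → toList u ≡ toList v → u ≡ v
toList-injective u v e = trans (sym (Vec.cast-is-id refl u)) (Vec.toList-injective refl u v e)

length-flatten : ∀ {k i} (Φ : Vec (Subset k) i) → length (flatten Φ) ≡ i
length-flatten Φ = Vec.length-toList (Vec.map toList Φ)

flatten-injective : ∀ {k i} (Φ Φ′ : Vec (Subset k) i) → flatten Φ ≡ flatten Φ′ → Φ ≡ Φ′
flatten-injective []      []        _ = refl
flatten-injective (p ∷ Φ) (p′ ∷ Φ′) e = let p≡p′ , Φ≡Φ′ = ∷-injective e in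
  cong₂ _∷_ (toList-injective p p′ p≡p′) (flatten-injective Φ Φ′ Φ≡Φ′)

flatten-fibres : ∀ {k k′ i} (w : Vec ℕ k) (w′ : Vec ℕ k′) → toList w ≡ toList w′ →
                 flatten (fibres i w) ≡ flatten (fibres i w′)
flatten-fibres {i = i} w w′ w≡w′ = begin
  toList (Vec.map toList (Vec.map (fibre w) (upToᵥ i)))
    ≡⟨ cong toList (Vec.map-∘ toList (fibre w) (upToᵥ i)) ⟨
  toList (Vec.map (λ y → toList (fibre w y)) (upToᵥ i))
    ≡⟨ cong toList (Vec.map-cong (λ y → trans (Vec.toList-map _ w) (trans (cong (map (_≡ᵇ y)) w≡w′)
                                                                       (sym (Vec.toList-map _ w′)))) (upToᵥ i)) ⟩
  toList (Vec.map (λ y → toList (fibre w′ y)) (upToᵥ i))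
    ≡⟨ cong toList (Vec.map-∘ toList (fibre w′) (upToᵥ i)) ⟩
  toList (Vec.map toList (Vec.map (fibre w′) (upToᵥ i))) ∎
  where open ≡-Reasoning

indexList : ∀ {k i} → Vec (Subset k) i → List ℕ
indexList Φ = toList (indexWord Φ)

indexList-injective : ∀ {k i} (Φ Φ′ : Vec (Subset k) i) → IsSetComp Φ → IsSetComp Φ′ →
                      indexList Φ ≡ indexList Φ′ → Φ ≡ Φ′
indexList-injective {i = i} Φ Φ′ Φ-comp Φ′-comp e = begin
  Φ                          ≡⟨ fibres-indexWord Φ Φ-comp ⟨
  fibres i (indexWord Φ)     ≡⟨ cong (fibres i) (toList-injective (indexWord Φ) (indexWord Φ′) e) ⟩
  fibres i (indexWord Φ′)    ≡⟨ fibres-indexWord Φ′ Φ′-comp ⟩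
  Φ′                         ∎
  where open ≡-Reasoning

toList-∣ : ∀ {j m} a (u : Vec ℕ j) (v : Vec ℕ m) →
           toList (u Vec.++ Vec.map (a +_) v) ≡ toList u ∣[ a ] toList v
toList-∣ a u v = trans (Vec.toList-++ u _) (cong (toList u ++_) (Vec.toList-map (a +_) v))

indexWord-∣∣ : ∀ {j m a b} (Ψ : Vec (Subset j) a) (Γ : Vec (Subset m) b) → IsSetComp Ψ → IsSetComp Γ →
               indexWord (Ψ ∣∣ Γ) ≡ indexWord Ψ Vec.++ Vec.map (a +_) (indexWord Γ)
indexWord-∣∣ {j} {m} {a} {b} Ψ Γ Ψ-comp Γ-comp = begin
  indexWord (Ψ ∣∣ Γ)
    ≡⟨ cong₂ (λ Ψ′ Γ′ → indexWord (Ψ′ ∣∣ Γ′)) (fibres-indexWord Ψ Ψ-comp) (fibres-indexWord Γ Γ-comp) ⟨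
  indexWord (fibres a (indexWord Ψ) ∣∣ fibres b (indexWord Γ))
    ≡⟨ cong indexWord (fibres-∣ (indexWord Ψ) (indexWord Γ) (SurjWord.bounded (SurjWord-indexWord Ψ Ψ-comp))) ⟩
  indexWord (fibres (a + b) X)
    ≡⟨ indexWord-fibres X X-surj ⟩
  X ∎
  where
  open ≡-Reasoning
  X = indexWord Ψ Vec.++ Vec.map (a +_) (indexWord Γ)
  X-surj : SurjWord (j + m) (a + b) (toList X)
  X-surj = subst (SurjWord _ _) (sym (toList-∣ a (indexWord Ψ) (indexWord Γ)))
    (SurjWord-∣ (SurjWord-indexWord Ψ Ψ-comp) (SurjWord-indexWord Γ Γ-comp))

CompSplitting : ∀ {n ℓ} → Vec (Subset n) ℓ → Set
CompSplitting {n} Φ = Σ ℕ λ j → Σ ℕ λ m → Σ ℕ λ a → Σ ℕ λ b →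
  Σ (Vec (Subset j) a) λ Ψ → Σ (Vec (Subset m) b) λ Γ →
    0 < j × 0 < m × j + m ≡ n × IsSetComp Ψ × IsSetComp Γ × flatten (Ψ ∣∣ Γ) ≡ flatten Φ

Splitting⇒CompSplitting : ∀ {k i} (Φ : Vec (Subset k) i) → IsSetComp Φ →
                          Splitting k (indexList Φ) → CompSplitting Φ
Splitting⇒CompSplitting {k} {i} Φ Φ-comp
  (splitting {a = a} {b} {u} {v} 0<j 0<m j+m≡k u-surj@(surjWord refl _ _) v-surj@(surjWord refl _ _) u∣v≡Φ) =
  length u , length v , a , b , fibres a u′ , fibres b v′ , 0<j , 0<m , j+m≡k ,
  fibres-IsSetComp u′ (SurjWord-fromList u-surj) , fibres-IsSetComp v′ (SurjWord-fromList v-surj) ,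
  (begin
    flatten (fibres a u′ ∣∣ fibres b v′)                   ≡⟨ cong flatten (fibres-∣ u′ v′ u′<a) ⟩
    flatten (fibres (a + b) (u′ Vec.++ Vec.map (a +_) v′)) ≡⟨ flatten-fibres _ (indexWord Φ) u′∣v′≡Φ ⟩
    flatten (fibres (a + b) (indexWord Φ))                 ≡⟨ cong (λ l → flatten (fibres l (indexWord Φ))) a+b≡i ⟩
    flatten (fibres i (indexWord Φ))                       ≡⟨ cong flatten (fibres-indexWord Φ Φ-comp) ⟩
    flatten Φ                                              ∎)
  where
  open ≡-Reasoning
  u′ = fromList u
  v′ = fromList v
  u′<a = SurjWord.bounded (SurjWord-fromList u-surj)
  u′∣v′≡Φ : toList (u′ Vec.++ Vec.map (a +_) v′) ≡ indexList Φ
  u′∣v′≡Φ = trans (toList-∣ a u′ v′)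
    (trans (cong₂ (λ l l′ → l ∣[ a ] l′) (Vec.toList∘fromList u) (Vec.toList∘fromList v)) u∣v≡Φ)
  a+b≡i : a + b ≡ i
  a+b≡i = SurjWord-letters-unique (subst (SurjWord _ _) u∣v≡Φ (SurjWord-∣ u-surj v-surj))
                                   (SurjWord-indexWord Φ Φ-comp)

CompSplitting⇒Splitting : ∀ {k i} (Φ : Vec (Subset k) i) → CompSplitting Φ → Splitting k (indexList Φ)
CompSplitting⇒Splitting Φ (j , m , a , b , Ψ , Γ , 0<j , 0<m , refl , Ψ-comp , Γ-comp , ΨΓ≡Φ)
  with refl ← trans (sym (length-flatten (Ψ ∣∣ Γ))) (trans (cong length ΨΓ≡Φ) (length-flatten Φ))
  with refl ← flatten-injective (Ψ ∣∣ Γ) Φ ΨΓ≡Φ =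
  splitting 0<j 0<m refl (SurjWord-indexWord Ψ Ψ-comp) (SurjWord-indexWord Γ Γ-comp)
    (trans (sym (toList-∣ a (indexWord Ψ) (indexWord Γ))) (cong toList (sym (indexWord-∣∣ Ψ Γ Ψ-comp Γ-comp))))

IsAtomic⇔AtomicWord : ∀ {k i} (Φ : Vec (Subset k) i) → IsSetComp Φ → IsAtomic Φ ⇔ AtomicWord k (indexList Φ)
IsAtomic⇔AtomicWord Φ Φ-comp = mk⇔
  (λ (1≤k , irreducible) → atomicWord 1≤k (irreducible ∘ Splitting⇒CompSplitting Φ Φ-comp))
  (λ (atomicWord 1≤k irreducible) → 1≤k , irreducible ∘ CompSplitting⇒Splitting Φ)

AtomicCounts : (ℕ → ℕ → ℕ) → Set
AtomicCounts c = ∀ k i → IsCount {Vec (Subset k) i} (λ Φ → IsSetComp Φ × IsAtomic Φ) (c k i)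

module Atoms {c : ℕ → ℕ → ℕ} (counts : AtomicCounts c) where

  atoms : ℕ → ℕ → List (List ℕ)
  atoms k i = map indexList (proj₁ (counts k i))

  private
    ∈-counted⇔ : ∀ {k i} {Φ : Vec (Subset k) i} → Φ ∈ proj₁ (counts k i) ⇔ (IsSetComp Φ × IsAtomic Φ)
    ∈-counted⇔ {k} {i} {Φ} = proj₂ (proj₂ (proj₂ (counts k i))) Φ

  length-atoms : ∀ k i → length (atoms k i) ≡ c k i
  length-atoms k i = trans (length-map indexList (proj₁ (counts k i))) (proj₁ (proj₂ (proj₂ (counts k i))))

  atoms-unique : ∀ k i → Unique (atoms k i)
  atoms-unique k i = map⁺-on
    (λ Φ∈ Φ′∈ → indexList-injective _ _ (proj₁ (Equivalence.to ∈-counted⇔ Φ∈))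
                                        (proj₁ (Equivalence.to ∈-counted⇔ Φ′∈)))
    (proj₁ (proj₂ (counts k i)))

  ∈-atoms⁻ : ∀ {k i u} → u ∈ atoms k i → SurjWord k i u × AtomicWord k u
  ∈-atoms⁻ u∈ with ∈-map⁻ indexList u∈
  ... | Φ , Φ∈ , refl = let Φ-comp , Φ-atomic = Equivalence.to ∈-counted⇔ Φ∈ in
    SurjWord-indexWord Φ Φ-comp , Equivalence.to (IsAtomic⇔AtomicWord Φ Φ-comp) Φ-atomic

  ∈-atoms⁺ : ∀ {k i u} → SurjWord k i u → AtomicWord k u → u ∈ atoms k i
  ∈-atoms⁺ {i = i} {u} u-surj@(surjWord refl _ _) u-atomic =
    subst (_∈ atoms _ i) Φ↦u (∈-map⁺ indexList (Equivalence.from ∈-counted⇔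
      (Φ-comp , Equivalence.from (IsAtomic⇔AtomicWord Φ Φ-comp) (subst (AtomicWord _) (sym Φ↦u) u-atomic))))
    where
    Φ = fibres i (fromList u)
    Φ-comp = fibres-IsSetComp (fromList u) (SurjWord-fromList u-surj)
    Φ↦u : indexList Φ ≡ u
    Φ↦u = trans (cong toList (indexWord-fibres (fromList u) (SurjWord-fromList u-surj))) (Vec.toList∘fromList u)

  counts-support : ∀ {k i} → 0 < c k i → 1 ≤ k × 1 ≤ i × i ≤ k
  counts-support {k} {i} 0<c with atoms k i in atoms≡ | length-atoms k i
  ... | []    | 0≡c = ⊥-elim (<-irrefl 0≡c 0<c)
  ... | u ∷ _ | _   = uncurry AtomicWord-support (∈-atoms⁻ (subst (u ∈_) (sym atoms≡) (here refl)))

  open Factorisations atoms atoms-unique ∈-atoms⁻ ∈-atoms⁺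

  atomicSeries*compSeries-suc : ∀ n r → (atomicSeries c *S compSeries) (suc n) r ≡ compSeries (suc n) r
  atomicSeries*compSeries-suc n r = begin
    (atomicSeries c *S compSeries) (suc n) r
      ≡⟨ sumTo-cong (suc n) (λ k → sumTo-cong r λ i → cong (ℤ._* compSeries (suc n ∸ k) (r ∸ i))
           (trans (atomicSeries-≡ counts-support k i) (cong ℤ.+_ (sym (length-atoms k i))))) ⟩
    (sumTo (suc n) λ k → sumTo r λ i → ℤ.+ length (atoms k i) ℤ.* compSeries (suc n ∸ k) (r ∸ i))
      ≡⟨ +length-factorisations (suc n) r ⟨
    ℤ.+ length (factorisations (suc n) r)
      ≡⟨ cong ℤ.+_ (length-factorisations (suc n) r (s≤s z≤n)) ⟩
    compSeries (suc n) r ∎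
    where open ≡-Reasoning

mainTheorem11 : (c : ℕ → ℕ → ℕ)
    → (∀ k i → IsCount {Vec (Subset k) i} (λ Φ → IsSetComp Φ × IsAtomic Φ) (c k i))
    → ∀ n r → ((oneS -S atomicSeries c) *S compSeries) n r ≡ oneS n r
mainTheorem11 c counts n r = begin
  ((oneS -S atomicSeries c) *S compSeries) n r
    ≡⟨ *S-distribʳ-minus oneS (atomicSeries c) compSeries n r ⟩
  (oneS *S compSeries) n r ℤ.- (atomicSeries c *S compSeries) n r
    ≡⟨ cong (ℤ._- (atomicSeries c *S compSeries) n r) (*S-identityˡ compSeries n r) ⟩
  compSeries n r ℤ.- (atomicSeries c *S compSeries) n r
    ≡⟨ by-length n ⟩
  oneS n r ∎
  where
  open ≡-Reasoning
  by-length : ∀ n → compSeries n r ℤ.- (atomicSeries c *S compSeries) n r ≡ oneS n r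
  by-length zero    = trans (cong (λ x → compSeries 0 r ℤ.- x) (atomicSeries*-zero c compSeries r))
                            (trans (ℤ.+-identityʳ (compSeries 0 r)) (compSeries-zero r))
  by-length (suc n) = trans (cong (λ x → compSeries (suc n) r ℤ.- x) (Atoms.atomicSeries*compSeries-suc counts n r))
                            (ℤ.+-inverseʳ (compSeries (suc n) r))
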